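{- Let $G$ be a finite group without any maximal cyclic subgroup of order $2$. Then the oriented diameter of the enhanced power graph $EPow(G)$ and the oriented diameter of the commuting graph $Com(G)$ are both at most $4$.
   Context: The enhanced power graph $EPow(G)$ of a group $G$ is the simple undirected graph with vertex set $G$ in which two distinct elements $x,y$ are adjacent if and only if there is $z\in G$ with $x,y\in\langle z\rangle$. The commuting graph $Com(G)$ is the simple undirected graph with vertex set $G$ in which two distinct elements $x,y$ are adjacent if and only if $xy=yx$. A cyclic subgroup $C$ of $G$ is a maximal cyclic subgroup if it is not properly contained in any cyclic subgroup of $G$. An orientation of an undirected graph $X$ assigns exactly one direction to each edge of $X$. For a directed graph $D$, $d_D(u,v)$ is the length of a shortest directed path from $u$ to $v$ ($\infty$ if none exists), and $diam(D)=\max_{u,v} d_D(u,v)$. The oriented diameter $OD(X)$ of $X$ is the minimum of $diam(D)$ over all directed graphs $D$ obtained from $X$ by an orientation. -}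

module Defs where

open import Level using (Level; _⊔_)
open import Algebra.Bundles using (Group)
open import Data.Nat using (ℕ; zero; suc; _≤_)
open import Data.Integer using (ℤ; +_; -[1+_])
open import Data.List using (List)
open import Data.List.Relation.Unary.Any using (Any)
open import Data.Product using (Σ; ∃; _×_)
open import Data.Sum using (_⊎_)
open import Relation.Nullary using (¬_)
open import Relation.Binary using (Rel; Decidable)

module GroupGraphs {c ℓ : Level} (G : Group c ℓ) where
  open Group G

  pow : Carrier → ℕ → Carrier
  pow x zero    = ε
  pow x (suc n) = x ∙ pow x n

  zpow : Carrier → ℤ → Carrier
  zpow x (+ n)      = pow x n
  zpow x -[1+ n ]   = (pow x (suc n)) ⁻¹

  InCyc : Carrier → Carrier → Set ℓ
  InCyc x z = ∃ λ (k : ℤ) → x ≈ zpow z k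

  _⊆Cyc_ : Carrier → Carrier → Set (c ⊔ ℓ)
  z ⊆Cyc w = ∀ x → InCyc x z → InCyc x w

  MaximalCyclic : Carrier → Set (c ⊔ ℓ)
  MaximalCyclic z = ∀ w → z ⊆Cyc w → w ⊆Cyc z

  CycOrder2 : Carrier → Set (c ⊔ ℓ)
  CycOrder2 z = Σ Carrier λ a → Σ Carrier λ b →
    ¬ (a ≈ b) × InCyc a z × InCyc b z × (∀ x → InCyc x z → (x ≈ a) ⊎ (x ≈ b))

  Finite : Set (c ⊔ ℓ)
  Finite = Σ (List Carrier) λ xs → ∀ x → Any (x ≈_) xs

  EPowAdj : Rel Carrier (c ⊔ ℓ)
  EPowAdj x y = ¬ (x ≈ y) × (∃ λ z → InCyc x z × InCyc y z)

  ComAdj : Rel Carrier ℓ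
  ComAdj x y = ¬ (x ≈ y) × ((x ∙ y) ≈ (y ∙ x))

  IsOrientation : ∀ {a} → Rel Carrier a → Rel Carrier (c ⊔ ℓ) → Set (c ⊔ ℓ ⊔ a)
  IsOrientation Adj D =
    (∀ {x x' y y'} → x ≈ x' → y ≈ y' → D x y → D x' y')
    × (∀ x y → D x y → Adj x y)
    × (∀ x y → Adj x y → (D x y × ¬ D y x) ⊎ (D y x × ¬ D x y))

  Walk : Rel Carrier (c ⊔ ℓ) → ℕ → Carrier → Carrier → Set (c ⊔ ℓ)
  Walk D zero    u v = Level.Lift (c ⊔ ℓ) (u ≈ v)
  Walk D (suc n) u v = ∃ λ w → D u w × Walk D n w v

  DiamLe : Rel Carrier (c ⊔ ℓ) → ℕ → Set (c ⊔ ℓ)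
  DiamLe D m = ∀ u v → ∃ λ n → n ≤ m × Walk D n u v

  ODLe : ∀ {a} → Rel Carrier a → ℕ → Set (Level.suc (c ⊔ ℓ) ⊔ a)
  ODLe Adj m = ∃ λ (D : Rel Carrier (c ⊔ ℓ)) → IsOrientation Adj D × DiamLe D m

{-# OPTIONS --safe #-}
module Submission where

-- Both graphs contain the power graph (x — y whenever x ∈ ⟨y⟩), and every such graph can be
-- oriented with the identity ε as a hub.  Fix a linear order ⋖ on G listing ε first, then the other involutions, then the remaining elements, and call x negative
-- (Neg x) when x⁻¹ ⋖ x.  Every edge points from its ⋖-smaller to its ⋖-larger end, except
-- that edges between ε and a negative element point towards ε.  Then ε reaches every v in
-- at most two steps (ε → v, or ε → v⁻¹ → v for negative v), and every u reaches ε in at most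
-- two steps: u → ε for negative u, u → u⁻¹ → ε for the other non-involutions, and
-- u → y → ε for an involution u ≠ ε, where y is a negative generator of a cyclic subgroup
-- properly containing ⟨u⟩.  Such a subgroup exists because ⟨u⟩ has order 2 and so is not
-- maximal cyclic; finiteness makes the search for it decidable, since membership in ⟨w⟩
-- only needs exponents below |G|.

open import Defs
open import Level using (Level; _⊔_; 0ℓ; Lift; lift; lower)
open import Algebra.Bundles using (Group)
open import Data.Fin.Base using (Fin; toℕ; fromℕ<)
import Data.Fin.Properties as Fin
open import Data.Integer.Base using (+_; -[1+_]; -_)
open import Data.List.Base using (List; []; _∷_; length)
open import Data.List.Relation.Unary.Any using (Any; there; any?; satisfied; tail)
import Data.List.Relation.Unary.Any as Any
open import Data.Nat.Base using (ℕ; zero; suc; _+_; _*_; _≤_; _<_; z≤n; s≤s)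
open import Data.Nat.DivMod using (_%_; _/_; m≡m%n+[m/n]*n; m%n<n)
import Data.Nat.Properties as ℕ
open import Data.Product.Base using (∃; _×_; _,_; proj₁; proj₂; swap)
open import Data.Product.Relation.Binary.Lex.Strict using (×-Lex; ×-compare)
open import Data.Product.Relation.Binary.Pointwise.NonDependent using (≡⇒≡×≡)
open import Data.Sum.Base using (_⊎_; inj₁; inj₂; [_,_])
import Data.Sum.Base as Sum
open import Function.Base using (_∘_; _on_)
open import Relation.Binary.Bundles using (Setoid)
open import Relation.Binary.Core using (Rel)
open import Relation.Binary.Definitions
  using (Decidable; Symmetric; Trichotomous; Tri; tri<; tri≈; tri>; _Respects_; _Respects₂_)
open import Relation.Binary.Consequences using (tri⇒asym; tri⇒irr; tri⇒dec<)
open import Relation.Binary.Construct.Intersection using (_∩_)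
open import Relation.Binary.PropositionalEquality as ≡ using (_≡_)
open import Relation.Nullary.Decidable using (Dec; yes; no; _×-dec_; _⊎-dec_; ¬?; map′)
open import Relation.Nullary.Negation using (¬_; contradiction)

module FirstIndex {a ℓ} (S : Setoid a ℓ) (_≟_ : Decidable (Setoid._≈_ S)) where
  open Setoid S
  open import Data.List.Membership.Setoid S using (_∈_)

  firstIndex : List Carrier → Carrier → ℕ
  firstIndex []       x = 0
  firstIndex (y ∷ ys) x with x ≟ y
  ... | yes _ = 0
  ... | no  _ = suc (firstIndex ys x)

  firstIndex-head : ∀ {x y} ys → x ≈ y → firstIndex (y ∷ ys) x ≡ 0
  firstIndex-head {x} {y} ys x≈y with x ≟ y
  ... | yes _   = ≡.refl
  ... | no x≉y = contradiction x≈y x≉y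

  firstIndex-cong : ∀ ys {x x'} → x ≈ x' → firstIndex ys x ≡ firstIndex ys x'
  firstIndex-cong []       _ = ≡.refl
  firstIndex-cong (y ∷ ys) {x} {x'} x≈x' with x ≟ y | x' ≟ y
  ... | yes _   | yes _    = ≡.refl
  ... | yes x≈y | no x'≉y  = contradiction (trans (sym x≈x') x≈y) x'≉y
  ... | no x≉y  | yes x'≈y = contradiction (trans x≈x' x'≈y) x≉y
  ... | no _    | no _     = ≡.cong suc (firstIndex-cong ys x≈x')

  firstIndex-injective : ∀ {ys x x'} → x ∈ ys → x' ∈ ys →
                         firstIndex ys x ≡ firstIndex ys x' → x ≈ x'
  firstIndex-injective {y ∷ ys} {x} {x'} x∈ x'∈ eq with x ≟ y | x' ≟ y
  ... | yes x≈y | yes x'≈y = trans x≈y (sym x'≈y)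
  ... | no x≉y  | no x'≉y  = firstIndex-injective (tail x≉y x∈) (tail x'≉y x'∈) (ℕ.suc-injective eq)
  firstIndex-injective {y ∷ ys} {x} {x'} _ _ () | yes _ | no _
  firstIndex-injective {y ∷ ys} {x} {x'} _ _ () | no _  | yes _

  firstIndex-< : ∀ {ys x} → x ∈ ys → firstIndex ys x < length ys
  firstIndex-< {y ∷ ys} {x} x∈ with x ≟ y
  ... | yes _   = s≤s z≤n
  ... | no x≉y = s≤s (firstIndex-< (tail x≉y x∈))

flipOn : ∀ {a r f} {A : Set a} → Rel A f → Rel A r → Rel A (r ⊔ f)
flipOn F _<_ x y = (x < y × ¬ F x y) ⊎ (y < x × F x y)

module _ {a ℓ} (S : Setoid a ℓ) where
  open Setoid S

  module _ {r f} {_<_ : Rel Carrier r} {F : Rel Carrier f} where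

    flipOn-trichotomous : Symmetric F → Decidable F → Trichotomous _≈_ _<_ →
                          Trichotomous _≈_ (flipOn F _<_)
    flipOn-trichotomous F-sym F? compare x y with compare x y | F? x y
    ... | tri< x<y x≉y y≮x | no ¬Fxy = tri< (inj₁ (x<y , ¬Fxy)) x≉y
      [ y≮x ∘ proj₁ , ¬Fxy ∘ F-sym ∘ proj₂ ]
    ... | tri< x<y x≉y y≮x | yes Fxy = tri> [ (λ (_ , ¬Fxy) → ¬Fxy Fxy) , y≮x ∘ proj₁ ] x≉y
      (inj₂ (x<y , F-sym Fxy))
    ... | tri≈ x≮y x≈y y≮x | _ =
      tri≈ [ x≮y ∘ proj₁ , y≮x ∘ proj₁ ] x≈y [ y≮x ∘ proj₁ , x≮y ∘ proj₁ ]
    ... | tri> x≮y x≉y y<x | no ¬Fxy = tri> [ x≮y ∘ proj₁ , ¬Fxy ∘ proj₂ ] x≉y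
      (inj₁ (y<x , ¬Fxy ∘ F-sym))
    ... | tri> x≮y x≉y y<x | yes Fxy = tri< (inj₂ (y<x , Fxy)) x≉y
      [ (λ (_ , ¬Fyx) → ¬Fyx (F-sym Fxy)) , x≮y ∘ proj₁ ]

    flipOn-respects₂ : F Respects₂ _≈_ → _<_ Respects₂ _≈_ → flipOn F _<_ Respects₂ _≈_
    flipOn-respects₂ (Fʳ , Fˡ) (<ʳ , <ˡ) =
        (λ y≈y' → Sum.map (λ (x<y , ¬F) → <ʳ y≈y' x<y , ¬F ∘ Fʳ (sym y≈y'))
                          (λ (y<x , F) → <ˡ y≈y' y<x , Fʳ y≈y' F))
      , (λ x≈x' → Sum.map (λ (x<y , ¬F) → <ˡ x≈x' x<y , ¬F ∘ Fˡ (sym x≈x'))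
                          (λ (y<x , F) → <ʳ x≈x' y<x , Fˡ x≈x' F))

module Graphs {c ℓ} (G : Group c ℓ) where
  open Group G
  open GroupGraphs G

  record Graph (Adj : Rel Carrier (c ⊔ ℓ)) : Set (c ⊔ ℓ) where
    field
      adj-resp   : ∀ {x x' y y'} → x ≈ x' → y ≈ y' → Adj x y → Adj x' y'
      adj-sym    : Symmetric Adj
      adj-irrefl : ∀ {x y} → Adj x y → ¬ x ≈ y

  record PowerSupergraph (Adj : Rel Carrier (c ⊔ ℓ)) : Set (c ⊔ ℓ) where
    field
      graph      : Graph Adj
      power-edge : ∀ {x y} → ¬ x ≈ y → InCyc x y → Adj x y
    open Graph graph public

  tournament-orientation : ∀ {Adj : Rel Carrier (c ⊔ ℓ)} {_⇒_ : Rel Carrier ℓ} → Graph Adj →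
                           Trichotomous _≈_ _⇒_ → _⇒_ Respects₂ _≈_ → IsOrientation Adj (Adj ∩ _⇒_)
  tournament-orientation {Adj} {_⇒_} X compare (⇒-respʳ , ⇒-respˡ) =
      (λ x≈x' y≈y' (adj , x⇒y) → adj-resp x≈x' y≈y' adj , ⇒-respˡ x≈x' (⇒-respʳ y≈y' x⇒y))
    , (λ _ _ → proj₁)
    , λ x y adj → orient adj (compare x y)
    where
      open Graph X
      orient : ∀ {x y} → Adj x y → Tri (x ⇒ y) (x ≈ y) (y ⇒ x) →
               ((Adj ∩ _⇒_) x y × ¬ (Adj ∩ _⇒_) y x) ⊎ ((Adj ∩ _⇒_) y x × ¬ (Adj ∩ _⇒_) x y)
      orient adj (tri< x⇒y _ y⇏x) = inj₁ ((adj , x⇒y) , y⇏x ∘ proj₂)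
      orient adj (tri≈ _ x≈y _)   = contradiction x≈y (adj-irrefl adj)
      orient adj (tri> x⇏y _ y⇒x) = inj₂ ((adj-sym adj , y⇒x) , x⇏y ∘ proj₂)

  DistLe : Rel Carrier (c ⊔ ℓ) → ℕ → Carrier → Carrier → Set (c ⊔ ℓ)
  DistLe D m u v = ∃ λ n → n ≤ m × Walk D n u v

  module _ {D : Rel Carrier (c ⊔ ℓ)} (D-respˡ : ∀ {x x' y} → x ≈ x' → D x y → D x' y) where

    walk-respˡ : ∀ {n u u' v} → u ≈ u' → Walk D n u v → Walk D n u' v
    walk-respˡ {zero}  u≈u' (lift u≈v)      = lift (trans (sym u≈u') u≈v)
    walk-respˡ {suc n} u≈u' (w , arc , walk) = w , D-respˡ u≈u' arc , walk

    walk-++ : ∀ m {n u w v} → Walk D m u w → Walk D n w v → Walk D (m + n) u v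
    walk-++ zero    (lift u≈w)       walk′ = walk-respˡ (sym u≈w) walk′
    walk-++ (suc m) (x , arc , walk) walk′ = x , arc , walk-++ m walk walk′

    diamLe-via : ∀ {m n} h → (∀ u → DistLe D m u h) → (∀ v → DistLe D n h v) → DiamLe D (m + n)
    diamLe-via h to from u v with to u | from v
    ... | k , k≤m , walk | k′ , k′≤n , walk′ = k + k′ , ℕ.+-mono-≤ k≤m k′≤n , walk-++ k walk walk′

  module _ {D : Rel Carrier (c ⊔ ℓ)} where

    distLe-refl : ∀ {m u v} → u ≈ v → DistLe D m u v
    distLe-refl u≈v = 0 , z≤n , lift u≈v

    distLe-arc : ∀ {m u v} → D u v → DistLe D (suc m) u v
    distLe-arc {v = v} arc = 1 , s≤s z≤n , v , arc , lift refl

    distLe-arc₂ : ∀ {m u w v} → D u w → D w v → DistLe D (2 + m) u v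
    distLe-arc₂ {w = w} {v} arc arc′ = 2 , s≤s (s≤s z≤n) , w , arc , v , arc′ , lift refl

  ODLe-map : ∀ {a b m} {Adj : Rel Carrier a} {Adj′ : Rel Carrier b} →
             (∀ {x y} → Adj x y → Adj′ x y) → (∀ {x y} → Adj′ x y → Adj x y) →
             ODLe Adj m → ODLe Adj′ m
  ODLe-map to from (D , (D-resp , arc⇒edge , orient) , diam) =
    D , (D-resp , (λ x y → to ∘ arc⇒edge x y) , (λ x y → orient x y ∘ from)) , diam

module Powers {c ℓ} (G : Group c ℓ) where
  open Group G
  open GroupGraphs G
  open import Algebra.Properties.Group G using (ε⁻¹≈ε; ⁻¹-involutive; ⁻¹-anti-homo-∙; ∙-cancelˡ)
  open import Algebra.Properties.Monoid.Mult monoid using (×-congʳ; ×-homo-+)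
    renaming (_×_ to _·_)
  open import Relation.Binary.Reasoning.Setoid setoid

  pow≡· : ∀ x n → pow x n ≡ n · x
  pow≡· x zero    = ≡.refl
  pow≡· x (suc n) = ≡.cong (x ∙_) (pow≡· x n)

  pow-cong : ∀ {x y} n → x ≈ y → pow x n ≈ pow y n
  pow-cong {x} {y} n x≈y rewrite pow≡· x n | pow≡· y n = ×-congʳ n x≈y

  pow-+ : ∀ x m n → pow x (m + n) ≈ pow x m ∙ pow x n
  pow-+ x m n rewrite pow≡· x (m + n) | pow≡· x m | pow≡· x n = ×-homo-+ x m n

  pow-comm : ∀ x n → pow x n ∙ x ≈ x ∙ pow x n
  pow-comm x n = begin
    pow x n ∙ x       ≈⟨ ∙-congˡ (identityʳ x) ⟨
    pow x n ∙ pow x 1 ≈⟨ pow-+ x n 1 ⟨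
    pow x (n + 1)     ≡⟨ ≡.cong (pow x) (ℕ.+-comm n 1) ⟩
    x ∙ pow x n       ∎

  pow-⁻¹ : ∀ x n → pow (x ⁻¹) n ≈ pow x n ⁻¹
  pow-⁻¹ x zero    = sym ε⁻¹≈ε
  pow-⁻¹ x (suc n) = begin
    x ⁻¹ ∙ pow (x ⁻¹) n ≈⟨ ∙-congˡ (pow-⁻¹ x n) ⟩
    x ⁻¹ ∙ pow x n ⁻¹   ≈⟨ ⁻¹-anti-homo-∙ (pow x n) x ⟨
    (pow x n ∙ x) ⁻¹    ≈⟨ ⁻¹-cong (pow-comm x n) ⟩
    (x ∙ pow x n) ⁻¹    ∎

  pow-*-ε : ∀ {x} m → pow x m ≈ ε → ∀ k → pow x (k * m) ≈ ε
  pow-*-ε     m xᵐ≈ε zero    = refl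
  pow-*-ε {x} m xᵐ≈ε (suc k) = begin
    pow x (m + k * m)       ≈⟨ pow-+ x m (k * m) ⟩
    pow x m ∙ pow x (k * m) ≈⟨ ∙-cong xᵐ≈ε (pow-*-ε m xᵐ≈ε k) ⟩
    ε ∙ ε                   ≈⟨ identityˡ ε ⟩
    ε                       ∎

  pow-cancel : ∀ x m n → pow x m ≈ pow x (m + n) → pow x n ≈ ε
  pow-cancel x m n xᵐ≈xᵐ⁺ⁿ = ∙-cancelˡ (pow x m) _ _ (begin
    pow x m ∙ pow x n ≈⟨ pow-+ x m n ⟨
    pow x (m + n)     ≈⟨ xᵐ≈xᵐ⁺ⁿ ⟨
    pow x m           ≈⟨ identityʳ (pow x m) ⟨
    pow x m ∙ ε       ∎)

  zpow-cong : ∀ {x y} k → x ≈ y → zpow x k ≈ zpow y k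
  zpow-cong (+ n)    x≈y = pow-cong n x≈y
  zpow-cong -[1+ n ] x≈y = ⁻¹-cong (pow-cong (suc n) x≈y)

  zpow-⁻¹ : ∀ x k → zpow (x ⁻¹) (- k) ≈ zpow x k
  zpow-⁻¹ x (+ zero)  = refl
  zpow-⁻¹ x (+ suc n) = trans (⁻¹-cong (pow-⁻¹ x (suc n))) (⁻¹-involutive _)
  zpow-⁻¹ x -[1+ n ]  = pow-⁻¹ x (suc n)

  commute-⁻¹ : ∀ {a y} → a ∙ y ≈ y ∙ a → a ⁻¹ ∙ y ≈ y ∙ a ⁻¹
  commute-⁻¹ {a} {y} ay≈ya = ∙-cancelˡ a _ _ (begin
    a ∙ (a ⁻¹ ∙ y) ≈⟨ assoc a (a ⁻¹) y ⟨
    a ∙ a ⁻¹ ∙ y   ≈⟨ ∙-congʳ (inverseʳ a) ⟩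
    ε ∙ y          ≈⟨ identityˡ y ⟩
    y              ≈⟨ identityʳ y ⟨
    y ∙ ε          ≈⟨ ∙-congˡ (inverseʳ a) ⟨
    y ∙ (a ∙ a ⁻¹) ≈⟨ assoc y a (a ⁻¹) ⟨
    y ∙ a ∙ a ⁻¹   ≈⟨ ∙-congʳ ay≈ya ⟨
    a ∙ y ∙ a ⁻¹   ≈⟨ assoc a y (a ⁻¹) ⟩
    a ∙ (y ∙ a ⁻¹) ∎)

  zpow-comm : ∀ x k → zpow x k ∙ x ≈ x ∙ zpow x k
  zpow-comm x (+ n)    = pow-comm x n
  zpow-comm x -[1+ n ] = commute-⁻¹ (pow-comm x (suc n))

  InCyc-self : ∀ x → InCyc x x
  InCyc-self x = + 1 , sym (identityʳ x)

  InCyc-ε : ∀ x → InCyc ε x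
  InCyc-ε x = + 0 , refl

  InCyc-⁻¹ : ∀ x → InCyc (x ⁻¹) x
  InCyc-⁻¹ x = -[1+ 0 ] , ⁻¹-cong (sym (identityʳ x))

  InCyc-respˡ : ∀ {x x' w} → x ≈ x' → InCyc x w → InCyc x' w
  InCyc-respˡ x≈x' (k , x≈wᵏ) = k , trans (sym x≈x') x≈wᵏ

  InCyc-respʳ : ∀ {x w w'} → w ≈ w' → InCyc x w → InCyc x w'
  InCyc-respʳ w≈w' (k , x≈wᵏ) = k , trans x≈wᵏ (zpow-cong k w≈w')

  InCyc-generator⁻¹ : ∀ {x w} → InCyc x w → InCyc x (w ⁻¹)
  InCyc-generator⁻¹ {w = w} (k , x≈wᵏ) = - k , trans x≈wᵏ (sym (zpow-⁻¹ w k))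

  InCyc⇒commute : ∀ {x w} → InCyc x w → x ∙ w ≈ w ∙ x
  InCyc⇒commute {x} {w} (k , x≈wᵏ) = begin
    x ∙ w        ≈⟨ ∙-congʳ x≈wᵏ ⟩
    zpow w k ∙ w ≈⟨ zpow-comm w k ⟩
    w ∙ zpow w k ≈⟨ ∙-congˡ x≈wᵏ ⟨
    w ∙ x        ∎

  selfInverse-resp : ∀ {x y} → x ≈ y → x ≈ x ⁻¹ → y ≈ y ⁻¹
  selfInverse-resp x≈y x≈x⁻¹ = trans (sym x≈y) (trans x≈x⁻¹ (⁻¹-cong x≈y))

  ≉⁻¹⇒≉ε : ∀ {x} → ¬ x ≈ x ⁻¹ → ¬ x ≈ ε
  ≉⁻¹⇒≉ε {x} x≉x⁻¹ x≈ε = x≉x⁻¹ (trans x≈ε (trans (sym ε⁻¹≈ε) (⁻¹-cong (sym x≈ε))))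

  ⁻¹-≉⁻¹ : ∀ {x} → ¬ x ≈ x ⁻¹ → ¬ x ⁻¹ ≈ x ⁻¹ ⁻¹
  ⁻¹-≉⁻¹ {x} x≉x⁻¹ x⁻¹≈x⁻¹⁻¹ = x≉x⁻¹ (sym (trans x⁻¹≈x⁻¹⁻¹ (⁻¹-involutive x)))

  involution-zpow : ∀ {w} → w ≈ w ⁻¹ → ∀ k → zpow w k ≈ ε ⊎ zpow w k ≈ w
  involution-zpow {w} w≈w⁻¹ (+ n)    = involution-pow n
    where
      involution-pow : ∀ n → pow w n ≈ ε ⊎ pow w n ≈ w
      involution-pow zero    = inj₁ refl
      involution-pow (suc n) = Sum.swap (Sum.map
        (λ wⁿ≈ε → trans (∙-congˡ wⁿ≈ε) (identityʳ w))
        (λ wⁿ≈w → trans (∙-congˡ (trans wⁿ≈w w≈w⁻¹)) (inverseʳ w))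
        (involution-pow n))
  involution-zpow {w} w≈w⁻¹ -[1+ n ] = Sum.map
    (λ wⁿ≈ε → trans (⁻¹-cong wⁿ≈ε) ε⁻¹≈ε)
    (λ wⁿ≈w → trans (⁻¹-cong wⁿ≈w) (sym w≈w⁻¹))
    (involution-zpow w≈w⁻¹ (+ suc n))

  involution-cycOrder2 : ∀ {u} → u ≈ u ⁻¹ → ¬ u ≈ ε → CycOrder2 u
  involution-cycOrder2 {u} u≈u⁻¹ u≉ε = ε , u , u≉ε ∘ sym , InCyc-ε u , InCyc-self u ,
    λ x (k , x≈uᵏ) → Sum.map (trans x≈uᵏ) (trans x≈uᵏ) (involution-zpow u≈u⁻¹ k)

  selfInverse-overgroups⇒maximalCyclic : ∀ {u} → ¬ u ≈ ε → (∀ w → InCyc u w → w ≈ w ⁻¹) →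
                                         MaximalCyclic u
  selfInverse-overgroups⇒maximalCyclic {u} u≉ε only w u⊆w x (k , x≈wᵏ) =
    [ (λ wᵏ≈ε → InCyc-respˡ (sym (trans x≈wᵏ wᵏ≈ε)) (InCyc-ε u))
    , (λ wᵏ≈w → InCyc-respˡ (sym (trans x≈wᵏ (trans wᵏ≈w (sym u≈w)))) (InCyc-self u))
    ] (involution-zpow w≈w⁻¹ k)
    where
      u∈⟨w⟩ : InCyc u w
      u∈⟨w⟩ = u⊆w u (InCyc-self u)
      w≈w⁻¹ : w ≈ w ⁻¹
      w≈w⁻¹ = only w u∈⟨w⟩
      u≈w : u ≈ w
      u≈w = let j , u≈wʲ = u∈⟨w⟩ in
        [ (λ wʲ≈ε → contradiction (trans u≈wʲ wʲ≈ε) u≉ε) , trans u≈wʲ ] (involution-zpow w≈w⁻¹ j)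

module FiniteGroup {c ℓ} (G : Group c ℓ) (_≟_ : Decidable (Group._≈_ G))
                   (xs : List (Group.Carrier G)) (cover : ∀ x → Any (Group._≈_ G x) xs) where
  open Group G
  open GroupGraphs G
  open Graphs G
  open Powers G
  open FirstIndex setoid _≟_
  open import Algebra.Properties.Group G using (ε⁻¹≈ε; ⁻¹-involutive; inverseʳ-unique)
  open import Relation.Binary.Reasoning.Setoid setoid

  elements : List Carrier
  elements = ε ∷ xs

  M : ℕ
  M = length elements

  index : Carrier → ℕ
  index = firstIndex elements

  index-injective : ∀ {x y} → index x ≡ index y → x ≈ y
  index-injective {x} {y} = firstIndex-injective {elements} (there (cover x)) (there (cover y))

  position : Carrier → Fin M
  position x = fromℕ< (firstIndex-< {elements} (there (cover x)))

  position-injective : ∀ {x y} → position x ≡ position y → x ≈ y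
  position-injective {x} {y} = index-injective ∘ Fin.fromℕ<-injective (index x) (index y) _ _

  period : ∀ w → ∃ λ d → pow w (suc d) ≈ ε × d < M
  period w with Fin.pigeonhole (ℕ.n<1+n M) (position ∘ pow w ∘ toℕ)
  ... | i , j , i<j , same with ℕ.m≤n⇒∃[o]m+o≡n i<j
  ...   | d , i+1+d≡j = d , pow-cancel w (toℕ i) (suc d) wⁱ≈wⁱ⁺ᵈ⁺¹ , d<M
    where
      i+[1+d]≡j : toℕ i + suc d ≡ toℕ j
      i+[1+d]≡j = ≡.trans (ℕ.+-suc (toℕ i) d) i+1+d≡j
      wⁱ≈wⁱ⁺ᵈ⁺¹ : pow w (toℕ i) ≈ pow w (toℕ i + suc d)
      wⁱ≈wⁱ⁺ᵈ⁺¹ = trans (position-injective same) (reflexive (≡.cong (pow w) (≡.sym i+[1+d]≡j)))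
      d<M : d < M
      d<M = ℕ.<-≤-trans (s≤s (ℕ.m≤n+m d (toℕ i)))
              (ℕ.≤-trans (ℕ.≤-reflexive i+1+d≡j) (ℕ.≤-pred (Fin.toℕ<n j)))

  module _ {w} d (wᵈ⁺¹≈ε : pow w (suc d) ≈ ε) where

    pow-mod : ∀ n → pow w n ≈ pow w (n % suc d)
    pow-mod n = begin
      pow w n                       ≡⟨ ≡.cong (pow w) (m≡m%n+[m/n]*n n (suc d)) ⟩
      pow w (r + q * suc d)         ≈⟨ pow-+ w r (q * suc d) ⟩
      pow w r ∙ pow w (q * suc d)   ≈⟨ ∙-congˡ (pow-*-ε (suc d) wᵈ⁺¹≈ε q) ⟩
      pow w r ∙ ε                   ≈⟨ identityʳ _ ⟩
      pow w r                       ∎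
      where
        r = n % suc d
        q = n / suc d

    zpow-as-pow : ∀ k → ∃ λ n → zpow w k ≈ pow w n
    zpow-as-pow (+ n)    = n , refl
    zpow-as-pow -[1+ n ] = suc n * d ,
      sym (inverseʳ-unique (pow w (suc n)) (pow w (suc n * d)) (begin
      pow w (suc n) ∙ pow w (suc n * d) ≈⟨ pow-+ w (suc n) (suc n * d) ⟨
      pow w (suc n + suc n * d)         ≡⟨ ≡.cong (pow w) (ℕ.*-suc (suc n) d) ⟨
      pow w (suc n * suc d)             ≈⟨ pow-*-ε (suc d) wᵈ⁺¹≈ε (suc n) ⟩
      ε                                 ∎))

  InCyc-bounded : ∀ {u w} → InCyc u w → ∃ λ (i : Fin M) → u ≈ pow w (toℕ i)
  InCyc-bounded {u} {w} (k , u≈wᵏ) with period w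
  ... | d , wᵈ⁺¹≈ε , d<M with zpow-as-pow d wᵈ⁺¹≈ε k
  ...   | n , wᵏ≈wⁿ = fromℕ< r<M , (begin
    u                    ≈⟨ u≈wᵏ ⟩
    zpow w k             ≈⟨ wᵏ≈wⁿ ⟩
    pow w n              ≈⟨ pow-mod d wᵈ⁺¹≈ε n ⟩
    pow w (n % suc d)    ≡⟨ ≡.cong (pow w) (Fin.toℕ-fromℕ< r<M) ⟨
    pow w (toℕ (fromℕ< r<M)) ∎)
    where
      r<M : n % suc d < M
      r<M = ℕ.<-≤-trans (m%n<n n (suc d)) d<M

  InCyc? : ∀ u w → Dec (InCyc u w)
  InCyc? u w = map′ (λ (i , u≈wⁱ) → + toℕ i , u≈wⁱ) InCyc-bounded
                    (Fin.any? λ i → u ≟ pow w (toℕ i))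

  class : Carrier → ℕ
  class x with x ≟ (x ⁻¹)
  ... | yes _ = 0
  ... | no  _ = 1

  class-involution : ∀ {x} → x ≈ x ⁻¹ → class x ≡ 0
  class-involution {x} x≈x⁻¹ with x ≟ (x ⁻¹)
  ... | yes _      = ≡.refl
  ... | no x≉x⁻¹ = contradiction x≈x⁻¹ x≉x⁻¹

  class-other : ∀ {x} → ¬ x ≈ x ⁻¹ → class x ≡ 1
  class-other {x} x≉x⁻¹ with x ≟ (x ⁻¹)
  ... | yes x≈x⁻¹ = contradiction x≈x⁻¹ x≉x⁻¹
  ... | no _       = ≡.refl

  class-cong : ∀ {x y} → x ≈ y → class x ≡ class y
  class-cong {x} {y} x≈y with y ≟ (y ⁻¹)
  ... | yes y≈y⁻¹ = class-involution (selfInverse-resp (sym x≈y) y≈y⁻¹)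
  ... | no y≉y⁻¹  = class-other (y≉y⁻¹ ∘ selfInverse-resp x≈y)

  rank : Carrier → ℕ × ℕ
  rank x = class x , index x

  rank-cong : ∀ {x y} → x ≈ y → rank x ≡ rank y
  rank-cong x≈y = ≡.cong₂ _,_ (class-cong x≈y) (firstIndex-cong elements x≈y)

  -- Lexicographic in (class, index): involutions before all other elements, and ε, which
  -- heads elements, before the other involutions.
  infix 4 _⋖_
  _⋖_ : Rel Carrier 0ℓ
  _⋖_ = ×-Lex _≡_ _<_ _<_ on rank

  ⋖-trichotomous : Trichotomous _≈_ _⋖_
  ⋖-trichotomous x y with ×-compare ≡.sym ℕ.<-cmp ℕ.<-cmp (rank x) (rank y)
  ... | tri< x⋖y x≉y y⋖̸x = tri< x⋖y (x≉y ∘ ≡⇒≡×≡ ∘ rank-cong) y⋖̸x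
  ... | tri≈ x⋖̸y x≈y y⋖̸x = tri≈ x⋖̸y (index-injective (proj₂ x≈y)) y⋖̸x
  ... | tri> x⋖̸y x≉y y⋖x = tri> x⋖̸y (x≉y ∘ ≡⇒≡×≡ ∘ rank-cong) y⋖x

  ⋖-respects₂ : _⋖_ Respects₂ _≈_
  ⋖-respects₂ = (λ {x} y≈y' → ≡.subst (×-Lex _≡_ _<_ _<_ (rank x)) (rank-cong y≈y'))
              , (λ {y} x≈x' → ≡.subst (λ r → ×-Lex _≡_ _<_ _<_ r (rank y)) (rank-cong x≈x'))

  involution⋖ : ∀ {u y} → u ≈ u ⁻¹ → ¬ y ≈ y ⁻¹ → u ⋖ y
  involution⋖ u≈u⁻¹ y≉y⁻¹ =
    inj₁ (≡.subst₂ _<_ (≡.sym (class-involution u≈u⁻¹)) (≡.sym (class-other y≉y⁻¹)) (s≤s z≤n))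

  index-ε : index ε ≡ 0
  index-ε = firstIndex-head xs refl

  index-ε-least : ∀ {v} → ¬ v ≈ ε → index ε < index v
  index-ε-least {v} v≉ε = ≡.subst (_< index v) (≡.sym index-ε)
    (ℕ.n≢0⇒n>0 λ v₀ → v≉ε (index-injective (≡.trans v₀ (≡.sym index-ε))))

  ε⋖ : ∀ {v} → ¬ v ≈ ε → ε ⋖ v
  ε⋖ {v} v≉ε = by-class (v ≟ (v ⁻¹))
    where
      ε≈ε⁻¹ : ε ≈ ε ⁻¹
      ε≈ε⁻¹ = sym ε⁻¹≈ε
      by-class : Dec (v ≈ v ⁻¹) → ε ⋖ v
      by-class (no v≉v⁻¹)  = involution⋖ ε≈ε⁻¹ v≉v⁻¹
      by-class (yes v≈v⁻¹) =
        inj₂ (≡.trans (class-involution ε≈ε⁻¹) (≡.sym (class-involution v≈v⁻¹)) , index-ε-least v≉ε)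

  Neg : Carrier → Set
  Neg x = x ⁻¹ ⋖ x

  Neg? : ∀ x → Dec (Neg x)
  Neg? x = tri⇒dec< ⋖-trichotomous (x ⁻¹) x

  Neg-resp : Neg Respects _≈_
  Neg-resp x≈x' = proj₁ ⋖-respects₂ x≈x' ∘ proj₂ ⋖-respects₂ (⁻¹-cong x≈x')

  Neg⇒≉⁻¹ : ∀ {x} → Neg x → ¬ x ≈ x ⁻¹
  Neg⇒≉⁻¹ x⁻¹⋖x x≈x⁻¹ = tri⇒irr ⋖-trichotomous (sym x≈x⁻¹) x⁻¹⋖x

  Neg-⁻¹ : ∀ {x} → x ⋖ x ⁻¹ → Neg (x ⁻¹)
  Neg-⁻¹ {x} = proj₂ ⋖-respects₂ (sym (⁻¹-involutive x))

  Neg⇒¬Neg-⁻¹ : ∀ {x} → Neg x → ¬ Neg (x ⁻¹)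
  Neg⇒¬Neg-⁻¹ {x} x⁻¹⋖x = tri⇒asym ⋖-trichotomous x⁻¹⋖x ∘ proj₂ ⋖-respects₂ (⁻¹-involutive x)

  εNegPair : Rel Carrier ℓ
  εNegPair x y = (x ≈ ε × Neg y) ⊎ (Neg x × y ≈ ε)

  εNegPair-respects₂ : εNegPair Respects₂ _≈_
  εNegPair-respects₂ =
      (λ y≈y' → Sum.map (λ (x≈ε , ny) → x≈ε , Neg-resp y≈y' ny)
                        (λ (nx , y≈ε) → nx , trans (sym y≈y') y≈ε))
    , (λ x≈x' → Sum.map (λ (x≈ε , ny) → trans (sym x≈x') x≈ε , ny)
                        (λ (nx , y≈ε) → Neg-resp x≈x' nx , y≈ε))

  infix 4 _⇒_
  _⇒_ : Rel Carrier ℓ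
  _⇒_ = flipOn εNegPair _⋖_

  ⇒-trichotomous : Trichotomous _≈_ _⇒_
  ⇒-trichotomous = flipOn-trichotomous setoid [ inj₂ ∘ swap , inj₁ ∘ swap ]
    (λ x y → ((x ≟ ε) ×-dec Neg? y) ⊎-dec (Neg? x ×-dec (y ≟ ε))) ⋖-trichotomous

  ⇒-respects₂ : _⇒_ Respects₂ _≈_
  ⇒-respects₂ = flipOn-respects₂ setoid εNegPair-respects₂ ⋖-respects₂

  ε⇒ : ∀ {v} → ¬ v ≈ ε → ¬ Neg v → ε ⇒ v
  ε⇒ v≉ε ¬nv = inj₁ (ε⋖ v≉ε , [ ¬nv ∘ proj₂ , v≉ε ∘ proj₂ ])

  ⇒ε : ∀ {y} → Neg y → y ⇒ ε
  ⇒ε ny = inj₂ (ε⋖ (≉⁻¹⇒≉ε (Neg⇒≉⁻¹ ny)) , inj₂ (ny , refl))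

  ⋖⇒⇒ : ∀ {x y} → ¬ x ≈ ε → ¬ y ≈ ε → x ⋖ y → x ⇒ y
  ⋖⇒⇒ x≉ε y≉ε x⋖y = inj₁ (x⋖y , [ x≉ε ∘ proj₁ , y≉ε ∘ proj₂ ])

  Neg-generator : ∀ {u w} → ¬ w ≈ w ⁻¹ → InCyc u w → ∃ λ y → Neg y × InCyc u y
  Neg-generator {w = w} w≉w⁻¹ u∈⟨w⟩ with ⋖-trichotomous (w ⁻¹) w
  ... | tri< w⁻¹⋖w _ _    = w , w⁻¹⋖w , u∈⟨w⟩
  ... | tri≈ _ w⁻¹≈w _    = contradiction (sym w⁻¹≈w) w≉w⁻¹
  ... | tri> _ _ w⋖w⁻¹    = w ⁻¹ , Neg-⁻¹ w⋖w⁻¹ , InCyc-generator⁻¹ u∈⟨w⟩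

  module _ (no-maximal-order-2 : ¬ (∃ λ z → CycOrder2 z × MaximalCyclic z)) where

    involution-in-Neg-cyclic : ∀ {u} → u ≈ u ⁻¹ → ¬ u ≈ ε → ∃ λ y → Neg y × InCyc u y
    involution-in-Neg-cyclic {u} u≈u⁻¹ u≉ε with any? (λ w → ¬? (w ≟ (w ⁻¹)) ×-dec InCyc? u w) xs
    ... | yes found = let _ , w≉w⁻¹ , u∈⟨w⟩ = satisfied found in Neg-generator w≉w⁻¹ u∈⟨w⟩
    ... | no none   = contradiction
      (u , involution-cycOrder2 u≈u⁻¹ u≉ε , selfInverse-overgroups⇒maximalCyclic u≉ε only)
      no-maximal-order-2
      where
        only : ∀ w → InCyc u w → w ≈ w ⁻¹
        only w u∈⟨w⟩ with w ≟ (w ⁻¹)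
        ... | yes w≈w⁻¹ = w≈w⁻¹
        ... | no w≉w⁻¹  = contradiction (Any.map
          (λ w≈z → w≉w⁻¹ ∘ selfInverse-resp (sym w≈z) , InCyc-respʳ w≈z u∈⟨w⟩) (cover w)) none

    module _ {Adj : Rel Carrier (c ⊔ ℓ)} (X : PowerSupergraph Adj) where
      open PowerSupergraph X

      D : Rel Carrier (c ⊔ ℓ)
      D = Adj ∩ _⇒_

      D-orientation : IsOrientation Adj D
      D-orientation = tournament-orientation graph ⇒-trichotomous ⇒-respects₂

      arc-to-generator : ∀ {x y} → ¬ x ≈ y → InCyc x y → x ⇒ y → D x y
      arc-to-generator x≉y x∈⟨y⟩ x⇒y = power-edge x≉y x∈⟨y⟩ , x⇒y

      arc-from-generator : ∀ {x y} → ¬ x ≈ y → InCyc y x → x ⇒ y → D x y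
      arc-from-generator x≉y y∈⟨x⟩ x⇒y = adj-sym (power-edge (x≉y ∘ sym) y∈⟨x⟩) , x⇒y

      from-ε : ∀ v → DistLe D 2 ε v
      from-ε v with v ≟ ε
      ... | yes v≈ε = distLe-refl (sym v≈ε)
      ... | no v≉ε with Neg? v
      ...   | no ¬nv = distLe-arc (arc-to-generator (v≉ε ∘ sym) (InCyc-ε v) (ε⇒ v≉ε ¬nv))
      ...   | yes nv = distLe-arc₂
        (arc-to-generator (v⁻¹≉ε ∘ sym) (InCyc-ε (v ⁻¹)) (ε⇒ v⁻¹≉ε (Neg⇒¬Neg-⁻¹ nv)))
        (arc-to-generator (Neg⇒≉⁻¹ nv ∘ sym) (InCyc-⁻¹ v) (⋖⇒⇒ v⁻¹≉ε v≉ε nv))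
        where
          v⁻¹≉ε : ¬ v ⁻¹ ≈ ε
          v⁻¹≉ε = ≉⁻¹⇒≉ε (⁻¹-≉⁻¹ (Neg⇒≉⁻¹ nv))

      to-ε : ∀ u → DistLe D 2 u ε
      to-ε u with ⋖-trichotomous (u ⁻¹) u
      ... | tri< nu _ _ = distLe-arc (arc-from-generator (≉⁻¹⇒≉ε (Neg⇒≉⁻¹ nu)) (InCyc-ε u) (⇒ε nu))
      ... | tri> _ u⁻¹≉u u⋖u⁻¹ = distLe-arc₂
        (arc-from-generator (u⁻¹≉u ∘ sym) (InCyc-⁻¹ u) (⋖⇒⇒ (≉⁻¹⇒≉ε u≉u⁻¹) u⁻¹≉ε u⋖u⁻¹))
        (arc-from-generator u⁻¹≉ε (InCyc-ε (u ⁻¹)) (⇒ε (Neg-⁻¹ u⋖u⁻¹)))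
        where
          u≉u⁻¹ : ¬ u ≈ u ⁻¹
          u≉u⁻¹ = u⁻¹≉u ∘ sym
          u⁻¹≉ε : ¬ u ⁻¹ ≈ ε
          u⁻¹≉ε = ≉⁻¹⇒≉ε (⁻¹-≉⁻¹ u≉u⁻¹)
      ... | tri≈ _ u⁻¹≈u _ with u ≟ ε
      ...   | yes u≈ε = distLe-refl u≈ε
      ...   | no u≉ε with involution-in-Neg-cyclic (sym u⁻¹≈u) u≉ε
      ...     | y , ny , u∈⟨y⟩ = distLe-arc₂
        (arc-to-generator (y≉y⁻¹ ∘ selfInverse-resp′) u∈⟨y⟩
          (⋖⇒⇒ u≉ε y≉ε (involution⋖ (sym u⁻¹≈u) y≉y⁻¹)))
        (arc-from-generator y≉ε (InCyc-ε y) (⇒ε ny))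
        where
          y≉y⁻¹ : ¬ y ≈ y ⁻¹
          y≉y⁻¹ = Neg⇒≉⁻¹ ny
          y≉ε : ¬ y ≈ ε
          y≉ε = ≉⁻¹⇒≉ε y≉y⁻¹
          selfInverse-resp′ : u ≈ y → y ≈ y ⁻¹
          selfInverse-resp′ u≈y = selfInverse-resp u≈y (sym u⁻¹≈u)

      oriented-diameter≤4 : ODLe Adj 4
      oriented-diameter≤4 = D , D-orientation ,
        diamLe-via (λ x≈x' → proj₁ D-orientation x≈x' refl) ε to-ε from-ε

module _ {c ℓ} (G : Group c ℓ) where
  open Group G
  open GroupGraphs G
  open Graphs G
  open Powers G

  epow-powerSupergraph : PowerSupergraph EPowAdj
  epow-powerSupergraph = record
    { graph = record
      { adj-resp   = λ x≈x' y≈y' (x≉y , z , x∈⟨z⟩ , y∈⟨z⟩) →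
          (λ x'≈y' → x≉y (trans x≈x' (trans x'≈y' (sym y≈y'))))
          , z , InCyc-respˡ x≈x' x∈⟨z⟩ , InCyc-respˡ y≈y' y∈⟨z⟩
      ; adj-sym    = λ (x≉y , z , x∈⟨z⟩ , y∈⟨z⟩) → x≉y ∘ sym , z , y∈⟨z⟩ , x∈⟨z⟩
      ; adj-irrefl = proj₁
      }
    ; power-edge = λ {x} {y} x≉y x∈⟨y⟩ → x≉y , y , x∈⟨y⟩ , InCyc-self y
    }

  -- Lifted into Set (c ⊔ ℓ), the universe in which orientations are taken.
  com-powerSupergraph : PowerSupergraph (λ x y → Lift c (ComAdj x y))
  com-powerSupergraph = record
    { graph = record
      { adj-resp   = λ x≈x' y≈y' (lift (x≉y , xy≈yx)) → lift
          ( (λ x'≈y' → x≉y (trans x≈x' (trans x'≈y' (sym y≈y'))))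
          , trans (∙-cong (sym x≈x') (sym y≈y')) (trans xy≈yx (∙-cong y≈y' x≈x')))
      ; adj-sym    = λ (lift (x≉y , xy≈yx)) → lift (x≉y ∘ sym , sym xy≈yx)
      ; adj-irrefl = proj₁ ∘ lower
      }
    ; power-edge = λ x≉y x∈⟨y⟩ → lift (x≉y , InCyc⇒commute x∈⟨y⟩)
    }

mainTheorem20 : ∀ {c ℓ : Level} (G : Group c ℓ) →
    let open Group G
        open GroupGraphs G
    in Decidable _≈_ → Finite →
       ¬ (∃ λ z → CycOrder2 z × MaximalCyclic z) →
       ODLe EPowAdj 4 × ODLe ComAdj 4
mainTheorem20 G _≟_ (xs , cover) no-maximal-order-2 =
    oriented-diameter≤4 no-maximal-order-2 (epow-powerSupergraph G)
  , ODLe-map lower lift (oriented-diameter≤4 no-maximal-order-2 (com-powerSupergraph G))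
  where
    open Graphs G using (ODLe-map)
    open FiniteGroup G _≟_ xs cover using (oriented-diameter≤4)
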